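{- For every $\bar c\in\mathbb{N}^m$ and $\bar d\in\mathbb{N}^n$, there exists a Presburger formula $\textsf{BiREG}_{(\bar c,\bar d)}(\bar X,\bar Y)$ with $\bar X=(X_1,\dots,X_m)$, $\bar Y=(Y_1,\dots,Y_n)$ such that for all $\bar M\in\mathbb{N}^m,\bar N\in\mathbb{N}^n$: there exists a $(\bar c,\bar d)$-biregular graph of size $(\bar M,\bar N)$ if and only if $\textsf{BiREG}_{(\bar c,\bar d)}(\bar M,\bar N)$ holds.
   Context: A Presburger formula is a first-order formula with $+,\le,0,1$ interpreted over $\mathbb{N}=\{0,1,2,\dots\}$. For $\bar c=(c_1,\dots,c_m)$ and $\bar d=(d_1,\dots,d_n)$, a $(\bar c,\bar d)$-biregular graph is a simple bipartite graph with vertex classes $U,V$ together with partitions $U=U_1\cup\dots\cup U_m$, $V=V_1\cup\dots\cup V_n$ (parts may be empty) such that every vertex in $U_j$ has degree exactly $c_j$ and every vertex in $V_j$ has degree exactly $d_j$; it has size $(\bar M,\bar N)$ if $\bar M=(|U_1|,\dots,|U_m|)$ and $\bar N=(|V_1|,\dots,|V_n|)$. -}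

module Defs where

open import Data.Nat using (ℕ; zero; suc; _+_; _≤_)
open import Data.Fin using (Fin; zero; suc)
open import Data.Bool using (Bool; true; false)
open import Data.Product using (_×_; Σ; ∃)
open import Data.Sum using (_⊎_)
open import Data.Empty using (⊥)
open import Data.Unit using (⊤)
open import Relation.Nullary using (¬_)
open import Relation.Binary.PropositionalEquality using (_≡_)

-- Presburger arithmetic: first-order logic over the signature (+, ≤, 0, 1)
-- interpreted in ℕ.  Variables are de Bruijn indices: a formula in
-- `Formula k` has its free variables among Fin k.

data Term (k : ℕ) : Set where
  var  : Fin k → Term k
  `0   : Term k
  `1   : Term k
  _`+_ : Term k → Term k → Term k

data Formula (k : ℕ) : Set where
  `⊤   : Formula k
  `⊥   : Formula k
  _`≡_ : Term k → Term k → Formula k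
  _`≤_ : Term k → Term k → Formula k
  `¬_  : Formula k → Formula k
  _`∧_ : Formula k → Formula k → Formula k
  _`∨_ : Formula k → Formula k → Formula k
  _`⇒_ : Formula k → Formula k → Formula k
  `∃   : Formula (suc k) → Formula k
  `∀   : Formula (suc k) → Formula k

_∷ₐ_ : ∀ {k} → ℕ → (Fin k → ℕ) → Fin (suc k) → ℕ
(x ∷ₐ ρ) zero    = x
(x ∷ₐ ρ) (suc i) = ρ i

⟦_⟧ₜ : ∀ {k} → Term k → (Fin k → ℕ) → ℕ
⟦ var i ⟧ₜ ρ    = ρ i
⟦ `0 ⟧ₜ ρ       = 0
⟦ `1 ⟧ₜ ρ       = 1
⟦ s `+ t ⟧ₜ ρ   = ⟦ s ⟧ₜ ρ + ⟦ t ⟧ₜ ρ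

⟦_⟧ : ∀ {k} → Formula k → (Fin k → ℕ) → Set
⟦ `⊤ ⟧ ρ      = ⊤
⟦ `⊥ ⟧ ρ      = ⊥
⟦ s `≡ t ⟧ ρ  = ⟦ s ⟧ₜ ρ ≡ ⟦ t ⟧ₜ ρ
⟦ s `≤ t ⟧ ρ  = ⟦ s ⟧ₜ ρ ≤ ⟦ t ⟧ₜ ρ
⟦ `¬ φ ⟧ ρ    = ¬ ⟦ φ ⟧ ρ
⟦ φ `∧ ψ ⟧ ρ  = ⟦ φ ⟧ ρ × ⟦ ψ ⟧ ρ
⟦ φ `∨ ψ ⟧ ρ  = ⟦ φ ⟧ ρ ⊎ ⟦ ψ ⟧ ρ
⟦ φ `⇒ ψ ⟧ ρ  = ⟦ φ ⟧ ρ → ⟦ ψ ⟧ ρ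
⟦ `∃ φ ⟧ ρ    = Σ ℕ λ x → ⟦ φ ⟧ (x ∷ₐ ρ)
⟦ `∀ φ ⟧ ρ    = (x : ℕ) → ⟦ φ ⟧ (x ∷ₐ ρ)

Σᶠ : (k : ℕ) → (Fin k → ℕ) → ℕ
Σᶠ zero    f = 0
Σᶠ (suc k) f = f zero + Σᶠ k (λ i → f (suc i))

⌊_⌋ : Bool → ℕ
⌊ true ⌋  = 1
⌊ false ⌋ = 0

-- The vertex class U is the disjoint union of U_j = Fin (M j) (j : Fin m),
-- V is the disjoint union of V_k = Fin (N k) (k : Fin n).  A simple
-- bipartite graph between U and V is an edge relation U → V → Bool.

module _ {m n : ℕ} where

  record BiregularGraph (c : Fin m → ℕ) (d : Fin n → ℕ)
                        (M : Fin m → ℕ) (N : Fin n → ℕ) : Set where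
    field
      edge : (j : Fin m) → Fin (M j) → (k : Fin n) → Fin (N k) → Bool
      degU : ∀ j (u : Fin (M j)) →
             Σᶠ n (λ k → Σᶠ (N k) (λ v → ⌊ edge j u k v ⌋)) ≡ c j
      degV : ∀ k (v : Fin (N k)) →
             Σᶠ m (λ j → Σᶠ (M j) (λ u → ⌊ edge j u k v ⌋)) ≡ d k

-- Counting the edges e j k between U_j and V_k shows that a biregular graph of size (M, N)
-- yields numbers with  ∑_k e j k = c j * M j,  ∑_j e j k = d k * N k  and  e j k ≤ M j * N k.
-- Conversely such numbers are realised round robin: the c j * M j edge ends of U_j, dealt
-- cyclically to its vertices, are cut into consecutive blocks of lengths e j k; a vertex u
-- gets at most N k ends of block k, and these are joined to a cyclically consecutive, hence
-- pairwise distinct, run of vertices of V_k.  Laying the runs of all u in all U_j end to end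
-- deals the d k * N k ends of V_k cyclically, so each vertex of V_k is hit d k times.
-- All conditions are linear except e j k ≤ M j * N k, which becomes linear by a finite case
-- distinction on M j, and BiREG existentially quantifies the e j k.

module Submission where

open import Defs
open import Data.Nat using (ℕ; _+_)
open import Data.Fin using (Fin)
open import Data.Product using (Σ)
open import Data.Vec.Functional using (_++_)
open import Function.Bundles using (_⇔_)

open import Data.Nat
  using (zero; suc; _*_; _∸_; _≤_; _<_; _≡ᵇ_; _<ᵇ_; NonZero; z≤n; s≤s; z<s)
open import Data.Nat.Properties
open import Data.Nat.DivMod using (_%_; [m+n]%n≡m%n; m<n⇒m%n≡m; m%n<n)
open import Data.Fin using (zero; suc; toℕ; fromℕ<; combine; remQuot; _↑ˡ_; _↑ʳ_)
open import Data.Fin.Properties using (nonZeroIndex; toℕ<n; toℕ-fromℕ<; remQuot-combine; ∀-cons; ∀-cons-⇔; ⊎⇔∃)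
open import Data.Product.Function.NonDependent.Propositional using (_×-⇔_)
open import Data.Sum.Function.Propositional using (_⊎-⇔_)
open import Data.Product using (_×_; _,_; proj₂; uncurry)
open import Data.Sum as Sum using (_⊎_; inj₁; inj₂; [_,_])
open import Data.Unit using (tt)
open import Data.Bool using (Bool; true; false)
open import Data.Vec.Functional using (Vector; foldr; tail)
open import Data.Vec.Functional.Properties using (lookup-++ˡ; lookup-++ʳ)
open import Algebra.Properties.CommutativeMonoid.Sum +-0-commutativeMonoid
  using (sum-syntax; sum-cong-≗; sum-replicate-zero; ∑-distrib-+; ∑-comm)
open import Function.Base using (_∘_)
open import Function.Bundles using (mk⇔; Equivalence)
open import Function.Construct.Composition using (_⇔-∘_)
open import Function.Construct.Symmetry using (⇔-sym)
open import Relation.Nullary using (yes; no)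
open import Relation.Nullary.Decidable using (dec-true; dec-false)
open import Relation.Binary.PropositionalEquality hiding ([_])

open ≡-Reasoning

Σᶠ≡∑ : ∀ p (f : Fin p → ℕ) → Σᶠ p f ≡ ∑[ i < p ] f i
Σᶠ≡∑ zero    f = refl
Σᶠ≡∑ (suc p) f = cong (f zero +_) (Σᶠ≡∑ p (f ∘ suc))

Σᶠ²≡∑∑ : ∀ p (q : Fin p → ℕ) (f : (i : Fin p) → Fin (q i) → ℕ) →
         Σᶠ p (λ i → Σᶠ (q i) (f i)) ≡ ∑[ i < p ] ∑[ j < q i ] f i j
Σᶠ²≡∑∑ p q f = trans (Σᶠ≡∑ p _) (sum-cong-≗ (λ i → Σᶠ≡∑ (q i) (f i)))

∑-const : ∀ p x → ∑[ i < p ] x ≡ p * x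
∑-const zero    x = refl
∑-const (suc p) x = cong (x +_) (∑-const p x)

∑-mono-≤ : ∀ {p} {f g : Fin p → ℕ} → (∀ i → f i ≤ g i) → ∑[ i < p ] f i ≤ ∑[ i < p ] g i
∑-mono-≤ {zero}  f≤g = z≤n
∑-mono-≤ {suc p} f≤g = +-mono-≤ (f≤g zero) (∑-mono-≤ (f≤g ∘ suc))

f≤∑f : ∀ {p} (f : Fin p → ℕ) i → f i ≤ ∑[ i < p ] f i
f≤∑f f zero    = m≤m+n _ _
f≤∑f f (suc i) = ≤-trans (f≤∑f (f ∘ suc) i) (m≤n+m _ _)

∑-indicator : ∀ {p} y → y < p → ∑[ i < p ] ⌊ y ≡ᵇ toℕ i ⌋ ≡ 1
∑-indicator {suc p} zero    _         = cong suc (sum-replicate-zero p)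
∑-indicator {suc p} (suc y) (s≤s y<p) = ∑-indicator y y<p

prefixSum : ∀ {p} → (Fin p → ℕ) → Fin p → ℕ
prefixSum f zero    = 0
prefixSum f (suc i) = f zero + prefixSum (f ∘ suc) i

visits : ∀ {N} → ℕ → ℕ → Fin N → ℕ
visits     x zero    v = 0
visits {N} x (suc l) v = ⌊ _%_ x N ⦃ nonZeroIndex v ⦄ ≡ᵇ toℕ v ⌋ + visits (suc x) l v

module _ {N} (v : Fin N) where
  private instance
    N≢0 : NonZero N
    N≢0 = nonZeroIndex v

  visits-+ : ∀ x a b → visits x (a + b) v ≡ visits x a v + visits (x + a) b v
  visits-+ x zero    b = cong (λ y → visits y b v) (sym (+-identityʳ x))
  visits-+ x (suc a) b = begin
    ⌊ x % N ≡ᵇ toℕ v ⌋ + visits (suc x) (a + b) v                       ≡⟨ cong (_ +_) (visits-+ (suc x) a b) ⟩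
    ⌊ x % N ≡ᵇ toℕ v ⌋ + (visits (suc x) a v + visits (suc x + a) b v)  ≡⟨ +-assoc ⌊ x % N ≡ᵇ toℕ v ⌋ _ _ ⟨
    visits x (suc a) v + visits (suc x + a) b v                         ≡⟨ cong (λ y → visits x (suc a) v + visits y b v) (+-suc x a) ⟨
    visits x (suc a) v + visits (x + suc a) b v                         ∎

  visits-+N : ∀ x l → visits (x + N) l v ≡ visits x l v
  visits-+N x zero    = refl
  visits-+N x (suc l) = cong₂ _+_ (cong (λ y → ⌊ y ≡ᵇ toℕ v ⌋) ([m+n]%n≡m%n x N)) (visits-+N (suc x) l)

  visits-period-suc : ∀ x → visits (suc x) N v ≡ visits x N v
  visits-period-suc x = +-cancelˡ-≡ ⌊ x % N ≡ᵇ toℕ v ⌋ _ _ (begin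
    visits x (suc N) v                       ≡⟨ cong (λ l → visits x l v) (+-comm 1 N) ⟩
    visits x (N + 1) v                       ≡⟨ visits-+ x N 1 ⟩
    visits x N v + visits (x + N) 1 v        ≡⟨ cong (visits x N v +_) (visits-+N x 1) ⟩
    visits x N v + (⌊ x % N ≡ᵇ toℕ v ⌋ + 0)  ≡⟨ cong (visits x N v +_) (+-identityʳ _) ⟩
    visits x N v + ⌊ x % N ≡ᵇ toℕ v ⌋        ≡⟨ +-comm (visits x N v) _ ⟩
    ⌊ x % N ≡ᵇ toℕ v ⌋ + visits x N v        ∎)

  visits-avoiding : ∀ x l → x + l ≤ N → toℕ v < x ⊎ x + l ≤ toℕ v → visits x l v ≡ 0
  visits-avoiding x zero    _     _       = refl
  visits-avoiding x (suc l) x+l≤N outside = cong₂ _+_ x≢v (visits-avoiding (suc x) l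
      (subst (_≤ N) (+-suc x l) x+l≤N)
      (Sum.map (λ v<x → ≤-trans v<x (n≤1+n x)) (subst (_≤ toℕ v) (+-suc x l)) outside))
    where
    x≢v : ⌊ x % N ≡ᵇ toℕ v ⌋ ≡ 0
    x≢v rewrite m<n⇒m%n≡m (≤-trans (m<m+n x z<s) x+l≤N) = cong ⌊_⌋ (dec-false (x ≟ toℕ v)
      ([ (λ v<x x≡v → <-irrefl (sym x≡v) v<x) , (λ x+l≤v x≡v → <-irrefl x≡v (≤-trans (m<m+n x z<s) x+l≤v)) ] outside))

  visits-period : ∀ x → visits x N v ≡ 1
  visits-period zero    = begin
    visits 0 N v                                          ≡⟨ cong (λ l → visits 0 l v) t+1+r≡N ⟨
    visits 0 (t + suc r) v                                ≡⟨ visits-+ 0 t (suc r) ⟩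
    visits 0 t v + (⌊ t % N ≡ᵇ t ⌋ + visits (suc t) r v)  ≡⟨ cong₂ _+_ before (cong₂ _+_ at after) ⟩
    1                                                     ∎
    where
    t r : ℕ
    t = toℕ v
    r = N ∸ suc t
    t+1+r≡N : t + suc r ≡ N
    t+1+r≡N = trans (+-suc t r) (m+[n∸m]≡n (toℕ<n v))
    before : visits 0 t v ≡ 0
    before = visits-avoiding 0 t (<⇒≤ (toℕ<n v)) (inj₂ ≤-refl)
    at : ⌊ t % N ≡ᵇ t ⌋ ≡ 1
    at rewrite m<n⇒m%n≡m (toℕ<n v) = cong ⌊_⌋ (dec-true (t ≟ t) refl)
    after : visits (suc t) r v ≡ 0
    after = visits-avoiding (suc t) r (≤-reflexive (trans (sym (+-suc t r)) t+1+r≡N)) (inj₁ (n<1+n t))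
  visits-period (suc x) = trans (visits-period-suc x) (visits-period x)

  visits-*N : ∀ x q → visits x (q * N) v ≡ q
  visits-*N x zero    = refl
  visits-*N x (suc q) = begin
    visits x (N + q * N) v                   ≡⟨ visits-+ x N (q * N) ⟩
    visits x N v + visits (x + N) (q * N) v  ≡⟨ cong₂ _+_ (visits-period x) (trans (visits-+N x (q * N)) (visits-*N x q)) ⟩
    suc q                                    ∎

  visits-≤ : ∀ x l q → l ≤ q * N → visits x l v ≤ q
  visits-≤ x l q l≤qN = subst (visits x l v ≤_) whole-periods (m≤m+n _ _)
    where
    whole-periods : visits x l v + visits (x + l) (q * N ∸ l) v ≡ q
    whole-periods = begin
      visits x l v + visits (x + l) (q * N ∸ l) v  ≡⟨ visits-+ x l (q * N ∸ l) ⟨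
      visits x (l + (q * N ∸ l)) v                 ≡⟨ cong (λ l′ → visits x l′ v) (m+[n∸m]≡n l≤qN) ⟩
      visits x (q * N) v                           ≡⟨ visits-*N x q ⟩
      q                                            ∎

  ∑-visits-prefixSum : ∀ {p} (f : Fin p → ℕ) x →
                     ∑[ i < p ] visits (x + prefixSum f i) (f i) v ≡ visits x (∑[ i < p ] f i) v
  ∑-visits-prefixSum {zero}  f x = refl
  ∑-visits-prefixSum {suc p} f x = begin
    visits (x + 0) (f zero) v + ∑[ i < p ] visits (x + (f zero + prefixSum (f ∘ suc) i)) (f (suc i)) v
      ≡⟨ cong₂ _+_ (cong (λ y → visits y (f zero) v) (+-identityʳ x))
                   (sum-cong-≗ (λ i → cong (λ y → visits y (f (suc i)) v) (sym (+-assoc x _ _)))) ⟩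
    visits x (f zero) v + ∑[ i < p ] visits (x + f zero + prefixSum (f ∘ suc) i) (f (suc i)) v
      ≡⟨ cong (visits x (f zero) v +_) (∑-visits-prefixSum (f ∘ suc) (x + f zero)) ⟩
    visits x (f zero) v + visits (x + f zero) (∑[ i < p ] f (suc i)) v
      ≡⟨ visits-+ x (f zero) _ ⟨
    visits x (∑[ i < suc p ] f i) v
      ∎

∑-visits : ∀ {N} x l → (N ≡ 0 → l ≡ 0) → ∑[ v < N ] visits x l v ≡ l
∑-visits {zero}  x l l≡0 = sym (l≡0 refl)
∑-visits {suc N} x l _   = go x l
  where
  go : ∀ x l → ∑[ v < suc N ] visits x l v ≡ l
  go x zero    = sum-replicate-zero (suc N)
  go x (suc l) = trans (∑-distrib-+ (λ v → ⌊ x % suc N ≡ᵇ toℕ v ⌋) (visits (suc x) l))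
                       (cong₂ _+_ (∑-indicator (x % suc N) (m%n<n x (suc N))) (go (suc x) l))

module _ {m n : ℕ} (c : Fin m → ℕ) (d : Fin n → ℕ) (M : Fin m → ℕ) (N : Fin n → ℕ) where

  record IsEdgeDistribution (e : Fin m → Fin n → ℕ) : Set where
    field
      rowSum  : ∀ j → ∑[ k < n ] e j k ≡ c j * M j
      colSum  : ∀ k → ∑[ j < m ] e j k ≡ d k * N k
      bounded : ∀ j k → e j k ≤ M j * N k

  EdgeDistribution : Set
  EdgeDistribution = Σ (Fin m → Fin n → ℕ) IsEdgeDistribution

module _ {m n : ℕ} {c : Fin m → ℕ} {d : Fin n → ℕ} {M : Fin m → ℕ} {N : Fin n → ℕ} where

  edgeDistribution : BiregularGraph c d M N → EdgeDistribution c d M N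
  edgeDistribution G = e , record { rowSum = rowSum ; colSum = colSum ; bounded = bounded }
    where
    open BiregularGraph G
    e : Fin m → Fin n → ℕ
    e j k = ∑[ u < M j ] ∑[ v < N k ] ⌊ edge j u k v ⌋

    rowSum : ∀ j → ∑[ k < n ] e j k ≡ c j * M j
    rowSum j = begin
      ∑[ k < n ] ∑[ u < M j ] ∑[ v < N k ] ⌊ edge j u k v ⌋  ≡⟨ ∑-comm (λ k u → ∑[ v < N k ] ⌊ edge j u k v ⌋) ⟩
      ∑[ u < M j ] ∑[ k < n ] ∑[ v < N k ] ⌊ edge j u k v ⌋  ≡⟨ sum-cong-≗ (λ u → trans (sym (Σᶠ²≡∑∑ n N _)) (degU j u)) ⟩
      ∑[ u < M j ] c j                                       ≡⟨ ∑-const (M j) (c j) ⟩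
      M j * c j                                              ≡⟨ *-comm (M j) (c j) ⟩
      c j * M j                                              ∎

    colSum : ∀ k → ∑[ j < m ] e j k ≡ d k * N k
    colSum k = begin
      ∑[ j < m ] ∑[ u < M j ] ∑[ v < N k ] ⌊ edge j u k v ⌋  ≡⟨ sum-cong-≗ (λ j → ∑-comm (λ u v → ⌊ edge j u k v ⌋)) ⟩
      ∑[ j < m ] ∑[ v < N k ] ∑[ u < M j ] ⌊ edge j u k v ⌋  ≡⟨ ∑-comm (λ j v → ∑[ u < M j ] ⌊ edge j u k v ⌋) ⟩
      ∑[ v < N k ] ∑[ j < m ] ∑[ u < M j ] ⌊ edge j u k v ⌋  ≡⟨ sum-cong-≗ (λ v → trans (sym (Σᶠ²≡∑∑ m M _)) (degV k v)) ⟩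
      ∑[ v < N k ] d k                                       ≡⟨ ∑-const (N k) (d k) ⟩
      N k * d k                                              ≡⟨ *-comm (N k) (d k) ⟩
      d k * N k                                              ∎

    ⌊b⌋≤1 : ∀ b → ⌊ b ⌋ ≤ 1
    ⌊b⌋≤1 false = z≤n
    ⌊b⌋≤1 true  = s≤s z≤n

    bounded : ∀ j k → e j k ≤ M j * N k
    bounded j k = ≤-trans (∑-mono-≤ (λ u → ∑-mono-≤ (λ v → ⌊b⌋≤1 (edge j u k v)))) (≤-reflexive (begin
      ∑[ u < M j ] ∑[ v < N k ] 1  ≡⟨ sum-cong-≗ {M j} (λ u → trans (∑-const (N k) 1) (*-identityʳ (N k))) ⟩
      ∑[ u < M j ] N k             ≡⟨ ∑-const (M j) (N k) ⟩
      M j * N k                    ∎))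

⌊0<ᵇn⌋≡n : ∀ {n} → n ≤ 1 → ⌊ 0 <ᵇ n ⌋ ≡ n
⌊0<ᵇn⌋≡n {zero}        _        = refl
⌊0<ᵇn⌋≡n {suc zero}    _        = refl
⌊0<ᵇn⌋≡n {suc (suc n)} (s≤s ())

module RoundRobin {m n : ℕ} {c : Fin m → ℕ} {d : Fin n → ℕ} {M : Fin m → ℕ} {N : Fin n → ℕ}
                  (e : Fin m → Fin n → ℕ) (isDist : IsEdgeDistribution c d M N e) where
  open IsEdgeDistribution isDist

  share : ∀ j k → Fin (M j) → ℕ
  share j k u = visits (prefixSum (e j) k) (e j k) u

  start : ∀ j k → Fin (M j) → ℕ
  start j k u = prefixSum (λ j′ → e j′ k) j + prefixSum (share j k) u

  edge : (j : Fin m) → Fin (M j) → (k : Fin n) → Fin (N k) → Bool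
  edge j u k v = 0 <ᵇ visits (start j k u) (share j k u) v

  share≤N : ∀ j k u → share j k u ≤ N k
  share≤N j k u = visits-≤ u _ (e j k) (N k) (subst (e j k ≤_) (*-comm (M j) (N k)) (bounded j k))

  ⌊edge⌋ : ∀ j u k v → ⌊ edge j u k v ⌋ ≡ visits (start j k u) (share j k u) v
  ⌊edge⌋ j u k v = ⌊0<ᵇn⌋≡n (visits-≤ v _ _ 1 (subst (share j k u ≤_) (sym (*-identityˡ (N k))) (share≤N j k u)))

  edges-to-V : ∀ j u k → ∑[ v < N k ] ⌊ edge j u k v ⌋ ≡ share j k u
  edges-to-V j u k = trans (sum-cong-≗ (⌊edge⌋ j u k)) (∑-visits _ _ (λ N≡0 →
    n≤0⇒n≡0 (subst (share j k u ≤_) N≡0 (share≤N j k u))))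

  ∑-share : ∀ j k → ∑[ u < M j ] share j k u ≡ e j k
  ∑-share j k = ∑-visits {M j} _ _ (λ M≡0 → n≤0⇒n≡0 (subst (λ x → e j k ≤ x * N k) M≡0 (bounded j k)))

  degree-U : ∀ j u → ∑[ k < n ] ∑[ v < N k ] ⌊ edge j u k v ⌋ ≡ c j
  degree-U j u = begin
    ∑[ k < n ] ∑[ v < N k ] ⌊ edge j u k v ⌋  ≡⟨ sum-cong-≗ (edges-to-V j u) ⟩
    ∑[ k < n ] share j k u                    ≡⟨ ∑-visits-prefixSum u (e j) 0 ⟩
    visits 0 (∑[ k < n ] e j k) u             ≡⟨ cong (λ l → visits 0 l u) (rowSum j) ⟩
    visits 0 (c j * M j) u                    ≡⟨ visits-*N u 0 (c j) ⟩
    c j                                       ∎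

  degree-V : ∀ k v → ∑[ j < m ] ∑[ u < M j ] ⌊ edge j u k v ⌋ ≡ d k
  degree-V k v = begin
    ∑[ j < m ] ∑[ u < M j ] ⌊ edge j u k v ⌋                      ≡⟨ sum-cong-≗ (λ j → sum-cong-≗ (λ u → ⌊edge⌋ j u k v)) ⟩
    ∑[ j < m ] ∑[ u < M j ] visits (start j k u) (share j k u) v  ≡⟨ sum-cong-≗ (λ j → ∑-visits-prefixSum v (share j k) _) ⟩
    ∑[ j < m ] visits (B j) (∑[ u < M j ] share j k u) v          ≡⟨ sum-cong-≗ (λ j → cong (λ l → visits (B j) l v) (∑-share j k)) ⟩
    ∑[ j < m ] visits (B j) (e j k) v                             ≡⟨ ∑-visits-prefixSum v (λ j → e j k) 0 ⟩
    visits 0 (∑[ j < m ] e j k) v                                 ≡⟨ cong (λ l → visits 0 l v) (colSum k) ⟩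
    visits 0 (d k * N k) v                                        ≡⟨ visits-*N v 0 (d k) ⟩
    d k                                                           ∎
    where
    B : Fin m → ℕ
    B = prefixSum (λ j → e j k)

  graph : BiregularGraph c d M N
  graph = record
    { edge = edge
    ; degU = λ j u → trans (Σᶠ²≡∑∑ n N _) (degree-U j u)
    ; degV = λ k v → trans (Σᶠ²≡∑∑ m M _) (degree-V k v)
    }

biregular⇔edgeDistribution : ∀ {m n} {c : Fin m → ℕ} {d : Fin n → ℕ} {M : Fin m → ℕ} {N : Fin n → ℕ} →
                             BiregularGraph c d M N ⇔ EdgeDistribution c d M N
biregular⇔edgeDistribution = mk⇔ edgeDistribution (λ (e , isDist) → RoundRobin.graph e isDist)

∑ₜ : ∀ {K p} → Vector (Term K) p → Term K
∑ₜ = foldr _`+_ `0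

infix 25 _·ₜ_

_·ₜ_ : ∀ {K} → ℕ → Term K → Term K
zero  ·ₜ t = `0
suc c ·ₜ t = t `+ c ·ₜ t

numeral : ∀ {K} → ℕ → Term K
numeral c = c ·ₜ `1

⋀ : ∀ {K p} → Vector (Formula K) p → Formula K
⋀ = foldr _`∧_ `⊤

⋁ : ∀ {K p} → Vector (Formula K) p → Formula K
⋁ = foldr _`∨_ `⊥

∃⋯ : ∀ {K} p → Formula (p + K) → Formula K
∃⋯ zero    φ = φ
∃⋯ (suc p) φ = ∃⋯ p (`∃ φ)

extend : ∀ {K} p → (Fin p → ℕ) → (Fin K → ℕ) → Fin (p + K) → ℕ
extend zero    xs ρ = ρ
extend (suc p) xs ρ = xs zero ∷ₐ extend p (xs ∘ suc) ρ

extend-↑ˡ : ∀ {K} p (xs : Fin p → ℕ) (ρ : Fin K → ℕ) i → extend p xs ρ (i ↑ˡ K) ≡ xs i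
extend-↑ˡ (suc p) xs ρ zero    = refl
extend-↑ˡ (suc p) xs ρ (suc i) = extend-↑ˡ p (xs ∘ suc) ρ i

extend-↑ʳ : ∀ {K} p (xs : Fin p → ℕ) (ρ : Fin K → ℕ) i → extend p xs ρ (p ↑ʳ i) ≡ ρ i
extend-↑ʳ zero    xs ρ i = refl
extend-↑ʳ (suc p) xs ρ i = extend-↑ʳ p (xs ∘ suc) ρ i

module _ {K : ℕ} (ρ : Fin K → ℕ) where

  ⟦∑ₜ⟧ : ∀ {p} (ts : Vector (Term K) p) → ⟦ ∑ₜ ts ⟧ₜ ρ ≡ ∑[ i < p ] ⟦ ts i ⟧ₜ ρ
  ⟦∑ₜ⟧ {zero}  ts = refl
  ⟦∑ₜ⟧ {suc p} ts = cong (⟦ ts zero ⟧ₜ ρ +_) (⟦∑ₜ⟧ (tail ts))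

  ⟦·ₜ⟧ : ∀ c (t : Term K) → ⟦ c ·ₜ t ⟧ₜ ρ ≡ c * ⟦ t ⟧ₜ ρ
  ⟦·ₜ⟧ zero    t = refl
  ⟦·ₜ⟧ (suc c) t = cong (⟦ t ⟧ₜ ρ +_) (⟦·ₜ⟧ c t)

  ⟦numeral⟧ : ∀ c → ⟦ numeral c ⟧ₜ ρ ≡ c
  ⟦numeral⟧ c = trans (⟦·ₜ⟧ c `1) (*-identityʳ c)

  ⋀-⇔ : ∀ {p} {φs : Vector (Formula K) p} {A : Fin p → Set} →
        (∀ i → ⟦ φs i ⟧ ρ ⇔ A i) → ⟦ ⋀ φs ⟧ ρ ⇔ (∀ i → A i)
  ⋀-⇔ {zero}  _ = mk⇔ (λ _ ()) (λ _ → tt)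
  ⋀-⇔ {suc p} φs⇔A = ∀-cons-⇔ ⇔-∘ (φs⇔A zero ×-⇔ ⋀-⇔ (φs⇔A ∘ suc))

  ⋁-⇔ : ∀ {p} {φs : Vector (Formula K) p} {A : Fin p → Set} →
        (∀ i → ⟦ φs i ⟧ ρ ⇔ A i) → ⟦ ⋁ φs ⟧ ρ ⇔ Σ (Fin p) A
  ⋁-⇔ {zero}  _ = mk⇔ (λ ()) (λ ())
  ⋁-⇔ {suc p} φs⇔A = ⊎⇔∃ ⇔-∘ (φs⇔A zero ⊎-⇔ ⋁-⇔ (φs⇔A ∘ suc))

∃⋯-⇔ : ∀ {K} p (φ : Formula (p + K)) (ρ : Fin K → ℕ) →
       ⟦ ∃⋯ p φ ⟧ ρ ⇔ Σ (Fin p → ℕ) λ xs → ⟦ φ ⟧ (extend p xs ρ)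
∃⋯-⇔ zero    φ ρ = mk⇔ ((λ ()) ,_) proj₂
∃⋯-⇔ (suc p) φ ρ = mk⇔ (λ (xs , x , φx) → ∀-cons x xs , φx) (λ (xs , φxs) → xs ∘ suc , xs zero , φxs)
                   ⇔-∘ ∃⋯-⇔ p (`∃ φ) ρ

subst₂-⇔ : (R : ℕ → ℕ → Set) {a a′ b b′ : ℕ} → a ≡ a′ → b ≡ b′ → R a b ⇔ R a′ b′
subst₂-⇔ R a≡a′ b≡b′ = mk⇔ (subst₂ R a≡a′ b≡b′) (subst₂ R (sym a≡a′) (sym b≡b′))

-- Since e ≤ d * N anyway, only the finitely many values M < d need the product.
≤*⇔≤-or-below : ∀ {e d M N} → e ≤ d * N →
                e ≤ M * N ⇔ (d ≤ M ⊎ Σ (Fin d) λ i → M ≡ toℕ i × e ≤ toℕ i * N)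
≤*⇔≤-or-below {e} {d} {M} {N} e≤dN = mk⇔ to [ (λ d≤M → ≤-trans e≤dN (*-monoˡ-≤ N d≤M)) , from-below ]
  where
  to : e ≤ M * N → d ≤ M ⊎ Σ (Fin d) λ i → M ≡ toℕ i × e ≤ toℕ i * N
  to e≤MN with d ≤? M
  ... | yes d≤M = inj₁ d≤M
  ... | no  d≰M = inj₂ (fromℕ< M<d , sym (toℕ-fromℕ< M<d) , subst (λ x → e ≤ x * N) (sym (toℕ-fromℕ< M<d)) e≤MN)
    where M<d = ≰⇒> d≰M
  from-below : Σ (Fin d) (λ i → M ≡ toℕ i × e ≤ toℕ i * N) → e ≤ M * N
  from-below (i , M≡i , e≤iN) = subst (λ x → e ≤ x * N) (sym M≡i) e≤iN

module _ {m n : ℕ} {c : Fin m → ℕ} {d : Fin n → ℕ} {M : Fin m → ℕ} {N : Fin n → ℕ} (e : Fin m → Fin n → ℕ) where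

  isEdgeDistribution⇔ :
    IsEdgeDistribution c d M N e ⇔
    ( (∀ j → ∑[ k < n ] e j k ≡ c j * M j)
    × (∀ k → ∑[ j < m ] e j k ≡ d k * N k)
    × (∀ j k → d k ≤ M j ⊎ Σ (Fin (d k)) λ i → M j ≡ toℕ i × e j k ≤ toℕ i * N k))
  isEdgeDistribution⇔ = mk⇔
    (λ isDist → let open IsEdgeDistribution isDist in
       rowSum , colSum , λ j k → Equivalence.to (≤*⇔≤-or-below (e≤dN colSum j k)) (bounded j k))
    (λ (rowSum , colSum , bounds) → record
       { rowSum = rowSum ; colSum = colSum
       ; bounded = λ j k → Equivalence.from (≤*⇔≤-or-below (e≤dN colSum j k)) (bounds j k) })
    where
    e≤dN : (∀ k → ∑[ j < m ] e j k ≡ d k * N k) → ∀ j k → e j k ≤ d k * N k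
    e≤dN colSum j k = subst (e j k ≤_) (colSum k) (f≤∑f (λ j → e j k) j)

module BiREG {m n : ℕ} (c : Fin m → ℕ) (d : Fin n → ℕ) where

  edgeVar : Fin m → Fin n → Term (m * n + (m + n))
  edgeVar j k = var (combine j k ↑ˡ (m + n))

  uVar : Fin m → Term (m * n + (m + n))
  uVar j = var (m * n ↑ʳ (j ↑ˡ n))

  vVar : Fin n → Term (m * n + (m + n))
  vVar k = var (m * n ↑ʳ (m ↑ʳ k))

  rowFormula : Fin m → Formula (m * n + (m + n))
  rowFormula j = ∑ₜ (edgeVar j) `≡ c j ·ₜ uVar j

  colFormula : Fin n → Formula (m * n + (m + n))
  colFormula k = ∑ₜ (λ j → edgeVar j k) `≡ d k ·ₜ vVar k

  boundFormula : Fin m → Fin n → Formula (m * n + (m + n))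
  boundFormula j k = (numeral (d k) `≤ uVar j)
                 `∨ ⋁ (λ (i : Fin (d k)) → (uVar j `≡ numeral (toℕ i)) `∧ (edgeVar j k `≤ toℕ i ·ₜ vVar k))

  matrixFormula : Formula (m * n + (m + n))
  matrixFormula = ⋀ rowFormula `∧ (⋀ colFormula `∧ ⋀ (λ j → ⋀ (boundFormula j)))

  formula : Formula (m + n)
  formula = ∃⋯ (m * n) matrixFormula

  ⟦matrixFormula⟧⇔ : ∀ {M N} (ρ : Fin (m * n + (m + n)) → ℕ) (e : Fin m → Fin n → ℕ) →
                    (∀ j k → ⟦ edgeVar j k ⟧ₜ ρ ≡ e j k) → (∀ j → ⟦ uVar j ⟧ₜ ρ ≡ M j) → (∀ k → ⟦ vVar k ⟧ₜ ρ ≡ N k) →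
                    ⟦ matrixFormula ⟧ ρ ⇔ IsEdgeDistribution c d M N e
  ⟦matrixFormula⟧⇔ {M} {N} ρ e ρ≡e ρ≡M ρ≡N = ⇔-sym (isEdgeDistribution⇔ e) ⇔-∘ (rows ×-⇔ cols ×-⇔ bounds)
    where
    ⟦·ₜ⟧-var : ∀ a {x} {t : Term (m * n + (m + n))} → ⟦ t ⟧ₜ ρ ≡ x → ⟦ a ·ₜ t ⟧ₜ ρ ≡ a * x
    ⟦·ₜ⟧-var a t≡x = trans (⟦·ₜ⟧ ρ a _) (cong (a *_) t≡x)
    rows : ⟦ ⋀ rowFormula ⟧ ρ ⇔ (∀ j → ∑[ k < n ] e j k ≡ c j * M j)
    rows = ⋀-⇔ ρ λ j → subst₂-⇔ _≡_ (trans (⟦∑ₜ⟧ ρ (edgeVar j)) (sum-cong-≗ (ρ≡e j))) (⟦·ₜ⟧-var (c j) (ρ≡M j))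
    cols : ⟦ ⋀ colFormula ⟧ ρ ⇔ (∀ k → ∑[ j < m ] e j k ≡ d k * N k)
    cols = ⋀-⇔ ρ λ k → subst₂-⇔ _≡_ (trans (⟦∑ₜ⟧ ρ (λ j → edgeVar j k)) (sum-cong-≗ (λ j → ρ≡e j k))) (⟦·ₜ⟧-var (d k) (ρ≡N k))
    bounds : ⟦ ⋀ (λ j → ⋀ (boundFormula j)) ⟧ ρ ⇔
             (∀ j k → d k ≤ M j ⊎ Σ (Fin (d k)) λ i → M j ≡ toℕ i × e j k ≤ toℕ i * N k)
    bounds = ⋀-⇔ ρ λ j → ⋀-⇔ ρ λ k →
      subst₂-⇔ _≤_ (⟦numeral⟧ ρ (d k)) (ρ≡M j)
      ⊎-⇔ ⋁-⇔ ρ λ i → subst₂-⇔ _≡_ (ρ≡M j) (⟦numeral⟧ ρ (toℕ i)) ×-⇔ subst₂-⇔ _≤_ (ρ≡e j k) (⟦·ₜ⟧-var (toℕ i) (ρ≡N k))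

  ⟦formula⟧⇔ : ∀ M N → ⟦ formula ⟧ (M ++ N) ⇔ EdgeDistribution c d M N
  ⟦formula⟧⇔ M N = mk⇔ fromAssignment toAssignment ⇔-∘ ∃⋯-⇔ (m * n) matrixFormula (M ++ N)
    where
    ρ≡M : ∀ xs j → ⟦ uVar j ⟧ₜ (extend (m * n) xs (M ++ N)) ≡ M j
    ρ≡M xs j = trans (extend-↑ʳ (m * n) xs (M ++ N) _) (lookup-++ˡ M N j)
    ρ≡N : ∀ xs k → ⟦ vVar k ⟧ₜ (extend (m * n) xs (M ++ N)) ≡ N k
    ρ≡N xs k = trans (extend-↑ʳ (m * n) xs (M ++ N) _) (lookup-++ʳ M N k)

    fromAssignment : Σ (Fin (m * n) → ℕ) (λ xs → ⟦ matrixFormula ⟧ (extend (m * n) xs (M ++ N))) → EdgeDistribution c d M N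
    fromAssignment (xs , sat) = e , Equivalence.to
      (⟦matrixFormula⟧⇔ _ e (λ j k → extend-↑ˡ (m * n) xs (M ++ N) (combine j k)) (ρ≡M xs) (ρ≡N xs)) sat
      where
      e : Fin m → Fin n → ℕ
      e j k = xs (combine j k)

    toAssignment : EdgeDistribution c d M N → Σ (Fin (m * n) → ℕ) (λ xs → ⟦ matrixFormula ⟧ (extend (m * n) xs (M ++ N)))
    toAssignment (e , isDist) = xs , Equivalence.from (⟦matrixFormula⟧⇔ _ e ρ≡e (ρ≡M xs) (ρ≡N xs)) isDist
      where
      xs : Fin (m * n) → ℕ
      xs i = uncurry e (remQuot n i)
      ρ≡e : ∀ j k → ⟦ edgeVar j k ⟧ₜ (extend (m * n) xs (M ++ N)) ≡ e j k
      ρ≡e j k = trans (extend-↑ˡ (m * n) xs (M ++ N) (combine j k)) (cong (uncurry e) (remQuot-combine j k))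

theorem7 : (m n : ℕ) (c : Fin m → ℕ) (d : Fin n → ℕ) →
    Σ (Formula (m + n)) λ BiREG →
      (M : Fin m → ℕ) (N : Fin n → ℕ) →
        BiregularGraph c d M N ⇔ ⟦ BiREG ⟧ (M ++ N)
theorem7 m n c d = formula , λ M N → ⇔-sym (⟦formula⟧⇔ M N) ⇔-∘ biregular⇔edgeDistribution
  where open BiREG c d
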